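{- Let $n \geq 1$ and $m \geq 3$ be integers. Then the graph $P_n + \overline{K_m}$ is super edge-magic if and only if $n \in \{1, 2\}$.
   Context: All graphs are finite and simple. For a graph $G$ with $p=|V(G)|$ vertices and $q=|E(G)|$ edges, a super edge-magic labeling is a bijection $f: V(G)\cup E(G)\to\{1,2,\ldots,p+q\}$ with $f(V(G))=\{1,\ldots,p\}$ such that $f(x)+f(xy)+f(y)$ is the same constant for every edge $xy$; $G$ is super edge-magic if it has such a labeling. The join $G_1+G_2$ of two vertex-disjoint graphs is their union together with all edges joining a vertex of $G_1$ to a vertex of $G_2$. $P_n$ is the path on $n$ vertices and $\overline{K_m}$ is the graph with $m$ vertices and no edges; so $P_n+\overline{K_m}$ has vertices $u_1,\ldots,u_n,v_1,\ldots,v_m$ and edges $u_iu_{i+1}$ ($1\le i\le n-1$) and $u_iv_j$ ($1\le i\le n$, $1\le j\le m$). -}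

module Defs where

open import Data.Nat using (ℕ; zero; suc; _+_; _*_; _<_; pred)
open import Data.Fin using (Fin; toℕ; inject₁; _↑ˡ_; _↑ʳ_; splitAt; remQuot)
open import Data.Fin as F using ()
open import Data.Sum using (_⊎_; inj₁; inj₂)
open import Data.Product using (Σ; ∃; _×_; _,_; proj₁; proj₂)
open import Relation.Binary.PropositionalEquality using (_≡_)
open import Function.Definitions using (Bijective)

record Graph : Set where
  field
    p    : ℕ
    q    : ℕ
    ends : Fin q → Fin p × Fin p

open Graph public

Elem : Graph → Set
Elem G = Fin (p G) ⊎ Fin (q G)

-- A super edge-magic labeling: a bijection f : V ∪ E → {1,…,p+q}
-- (encoded as Fin (p+q), label value = toℕ + 1) with f(V) = {1,…,p}
-- (i.e. vertex labels are ≤ p; by bijectivity the vertices then get exactly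
-- {1..p}), and f(x)+f(xy)+f(y) constant over all edges xy.
record SuperEdgeMagicLabeling (G : Graph) : Set where
  field
    f         : Elem G → Fin (p G + q G)
    bijective : Bijective _≡_ _≡_ f
    vertices  : ∀ (v : Fin (p G)) → toℕ (f (inj₁ v)) < p G
    magic     : ∃ λ (k : ℕ) → ∀ (e : Fin (q G)) →
                  suc (toℕ (f (inj₁ (proj₁ (ends G e)))))
                    + suc (toℕ (f (inj₂ e)))
                    + suc (toℕ (f (inj₁ (proj₂ (ends G e))))) ≡ k

SuperEdgeMagic : Graph → Set
SuperEdgeMagic G = SuperEdgeMagicLabeling G

pathEnds : ∀ n → Fin (pred n) → Fin n × Fin n
pathEnds zero    ()
pathEnds (suc k) i = inject₁ i , F.suc i

-- P_n + complement(K_m): vertices u_i = i ↑ˡ m (i : Fin n), v_j = n ↑ʳ j (j : Fin m);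
-- edges: first the n-1 path edges u_i u_{i+1}, then the n*m edges u_i v_j.
joinEnds : ∀ n m → Fin (pred n + n * m) → Fin (n + m) × Fin (n + m)
joinEnds n m e with splitAt (pred n) e
... | inj₁ i with pathEnds n i
...   | (a , b) = (a ↑ˡ m) , (b ↑ˡ m)
joinEnds n m e | inj₂ c with remQuot {n} m c
...   | (i , j) = (i ↑ˡ m) , (n ↑ʳ j)

PathJoinEmpty : ℕ → ℕ → Graph
PathJoinEmpty n m = record { p = n + m ; q = pred n + n * m ; ends = joinEnds n m }

-- Since f(x) + f(xy) + f(y) is constant and edge labels are distinct, the sums of the vertex
-- labels over the edges are pairwise distinct; conversely an injective vertex labeling whose edge
-- sums are consecutive extends to a super edge-magic one by labelling the edges in reverse order
-- of their sums.  Counting labels from 0, sums of two distinct vertex labels lie in [1, 2p − 3],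
-- so q ≤ 2p − 3.  For P_n + K̄_m we have q − (2p − 3) = (n − 2)(m − 1), which rules out n ≥ 3,
-- while for n = 1, 2 there are explicit vertex labelings with consecutive edge sums.
module Submission where

open import Defs
open import Data.Nat using (ℕ; zero; suc; _+_; _*_; _∸_; _≤_; _<_; z≤n; s≤s; pred)
open import Data.Nat.Properties
open import Data.Nat.Tactic.RingSolver using (solve-∀)
open import Data.Fin using (Fin; toℕ; fromℕ<; splitAt; punchOut; _↑ˡ_; _↑ʳ_)
import Data.Fin as F
open import Data.Fin.Properties
  using (toℕ-injective; toℕ-fromℕ<; toℕ<n; toℕ-inject₁; toℕ-↑ˡ; toℕ-↑ʳ; ↑ˡ-injective;
         splitAt-↑ˡ; splitAt-↑ʳ; splitAt⁻¹-↑ˡ; splitAt⁻¹-↑ʳ; join-splitAt; punchOut-injective; any?; injective⇒≤)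
open import Data.Sum using (_⊎_; inj₁; inj₂)
open import Data.Sum.Properties using (inj₁-injective; inj₂-injective)
open import Data.Product using (_×_; _,_; proj₁; proj₂)
open import Data.Empty using (⊥-elim)
open import Function using (_∘_)
open import Function.Bundles using (_⇔_; mk⇔)
open import Function.Definitions using (Injective; Surjective; StrictlySurjective)
open import Function.Consequences.Propositional using (strictlySurjective⇒surjective)
open import Relation.Binary.Definitions using (tri<; tri≈; tri>)
open import Relation.Binary.PropositionalEquality
open import Relation.Nullary using (¬_; yes; no)
open import Relation.Nullary.Negation using (contradiction)

injective⇒strictlySurjective : ∀ {N} {h : Fin N → Fin N} → Injective _≡_ _≡_ h → StrictlySurjective _≡_ h
injective⇒strictlySurjective {zero} _ ()
injective⇒strictlySurjective {suc N} {h} h-injective y with any? (λ x → h x F.≟ y)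
... | yes hit = hit
... | no miss = contradiction (injective⇒≤ {f = h′} h′-injective) (<-irrefl refl)
  where
  y≢h : ∀ x → y ≢ h x
  y≢h x y≡hx = miss (x , sym y≡hx)
  h′ : Fin (suc N) → Fin N
  h′ x = punchOut (y≢h x)
  h′-injective : Injective _≡_ _≡_ h′
  h′-injective = h-injective ∘ punchOut-injective (y≢h _) (y≢h _)

↑ˡ≢↑ʳ : ∀ {m n} (i : Fin m) (j : Fin n) → i ↑ˡ n ≢ m ↑ʳ j
↑ˡ≢↑ʳ {m} {n} i j eq with () ← trans (sym (splitAt-↑ˡ m i n)) (trans (cong (splitAt m) eq) (splitAt-↑ʳ m n j))

toℕ-splitAt-inj₁ : ∀ {m n} {i : Fin (m + n)} {j} → splitAt m i ≡ inj₁ j → toℕ i ≡ toℕ j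
toℕ-splitAt-inj₁ {n = n} {j = j} eq = trans (cong toℕ (sym (splitAt⁻¹-↑ˡ eq))) (toℕ-↑ˡ j n)

toℕ-splitAt-inj₂ : ∀ {m n} {i : Fin (m + n)} {j} → splitAt m i ≡ inj₂ j → toℕ i ≡ m + toℕ j
toℕ-splitAt-inj₂ {m} {j = j} eq = trans (cong toℕ (sym (splitAt⁻¹-↑ʳ eq))) (toℕ-↑ʳ m j)

magicSum-rearrange : ∀ a b c → suc a + suc c + suc b ≡ 3 + (a + b) + c
magicSum-rearrange = solve-∀

injective-in-range⇒≤ : ∀ {q lo hi} {g : Fin q → ℕ} → Injective _≡_ _≡_ g →
  (∀ i → lo ≤ g i) → (∀ i → g i ≤ hi) → q ≤ suc hi ∸ lo
injective-in-range⇒≤ {q} {lo} {hi} {g} g-injective lo≤g g≤hi = injective⇒≤ {f = shifted} shifted-injective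
  where
  shifted : Fin q → Fin (suc hi ∸ lo)
  shifted i = fromℕ< (∸-monoˡ-< (s≤s (g≤hi i)) (lo≤g i))
  shifted-injective : Injective _≡_ _≡_ shifted
  shifted-injective {i} {j} eq = g-injective (∸-cancelʳ-≡ (lo≤g i) (lo≤g j)
    (trans (sym (toℕ-fromℕ< _)) (trans (cong toℕ eq) (toℕ-fromℕ< _))))

PairSumRange : ℕ → ℕ → Set
PairSumRange p s = 1 ≤ s × s ≤ p + p ∸ 3

<-sum-range : ∀ {a b p} → a < b → b < p → PairSumRange p (a + b)
<-sum-range {a} {b} {p} a<b b<p = ≤-trans (≤-trans (s≤s z≤n) a<b) (m≤n+m b a) , m+n≤o⇒m≤o∸n (a + b) a+b+3≤p+p
  where
  a+b+3≤p+p : a + b + 3 ≤ p + p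
  a+b+3≤p+p = subst (_≤ p + p) reorder (+-mono-≤ (≤-trans (s≤s a<b) b<p) b<p)
    where
    reorder : suc (suc a) + suc b ≡ a + b + 3
    reorder = trans (cong (suc ∘ suc) (+-suc a b)) (+-comm 3 (a + b))

distinct-sum-range : ∀ {a b p} → a ≢ b → a < p → b < p → PairSumRange p (a + b)
distinct-sum-range {a} {b} {p} a≢b a<p b<p with <-cmp a b
... | tri< a<b _ _ = <-sum-range a<b b<p
... | tri≈ _ a≡b _ = contradiction a≡b a≢b
... | tri> _ _ b<a = subst (PairSumRange p) (+-comm b a) (<-sum-range b<a a<p)

edgeSum : (G : Graph) → (Fin (p G) → ℕ) → Fin (q G) → ℕ
edgeSum G V e = V (proj₁ (ends G e)) + V (proj₂ (ends G e))

Loopless : Graph → Set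
Loopless G = ∀ e → proj₁ (ends G e) ≢ proj₂ (ends G e)

module _ {G : Graph} (L : SuperEdgeMagicLabeling G) where
  open SuperEdgeMagicLabeling L

  vertexLabel : Fin (p G) → ℕ
  vertexLabel v = toℕ (f (inj₁ v))

  vertexLabel-injective : Injective _≡_ _≡_ vertexLabel
  vertexLabel-injective = inj₁-injective ∘ proj₁ bijective ∘ toℕ-injective

  edgeSum-injective : Injective _≡_ _≡_ (edgeSum G vertexLabel)
  edgeSum-injective {e} {e′} eq = inj₂-injective (proj₁ bijective (toℕ-injective
    (+-cancelˡ-≡ (3 + S e′) _ _ (begin
      3 + S e′ + c e                             ≡⟨ cong (λ s → 3 + s + c e) eq ⟨
      3 + S e + c e                              ≡⟨ magicSum-rearrange (a e) (b e) (c e) ⟨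
      suc (a e) + suc (c e) + suc (b e)          ≡⟨ trans (proj₂ magic e) (sym (proj₂ magic e′)) ⟩
      suc (a e′) + suc (c e′) + suc (b e′)       ≡⟨ magicSum-rearrange (a e′) (b e′) (c e′) ⟩
      3 + S e′ + c e′                            ∎))))
    where
    open ≡-Reasoning
    S : Fin (q G) → ℕ
    S = edgeSum G vertexLabel
    a b c : Fin (q G) → ℕ
    a e = vertexLabel (proj₁ (ends G e))
    b e = vertexLabel (proj₂ (ends G e))
    c e = toℕ (f (inj₂ e))

superEdgeMagic⇒size≤ : ∀ G → Loopless G → SuperEdgeMagic G → q G ≤ p G + p G ∸ 3
superEdgeMagic⇒size≤ G loopless L =
  injective-in-range⇒≤ (edgeSum-injective L) (proj₁ ∘ sumRange) (proj₂ ∘ sumRange)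
  where
  open SuperEdgeMagicLabeling L using (vertices)
  sumRange : ∀ e → PairSumRange (p G) (edgeSum G (vertexLabel L) e)
  sumRange e = distinct-sum-range (loopless e ∘ vertexLabel-injective L) (vertices _) (vertices _)

fin⊎fin-injective⇒surjective : ∀ {m n} {g : Fin m ⊎ Fin n → Fin (m + n)} →
  Injective _≡_ _≡_ g → Surjective _≡_ _≡_ g
fin⊎fin-injective⇒surjective {m} {n} {g} g-injective = strictlySurjective⇒surjective hit
  where
  splitAt-injective : Injective _≡_ _≡_ (splitAt m {n})
  splitAt-injective {i} {j} eq =
    trans (sym (join-splitAt m n i)) (trans (cong (F.join m n) eq) (join-splitAt m n j))
  hit : StrictlySurjective _≡_ g
  hit y with x , gx≡y ← injective⇒strictlySurjective {h = g ∘ splitAt m} (splitAt-injective ∘ g-injective) y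
    = splitAt m x , gx≡y

-- The edge with sum S gets label p + q + s - S, so every edge totals p + q + s + 2.
consecutiveEdgeSums⇒superEdgeMagic : ∀ (G : Graph) (V : Fin (p G) → ℕ) s →
  (∀ v → V v < p G) → Injective _≡_ _≡_ V →
  (∀ e → s ≤ edgeSum G V e) → (∀ e → edgeSum G V e < s + q G) → Injective _≡_ _≡_ (edgeSum G V) →
  SuperEdgeMagic G
consecutiveEdgeSums⇒superEdgeMagic G V s V<p V-injective s≤S S<s+q S-injective = record
  { f         = f
  ; bijective = f-injective , fin⊎fin-injective⇒surjective f-injective
  ; vertices  = λ v → subst (_< p G) (sym (toℕ-f-inj₁ v)) (V<p v)
  ; magic     = 2 + p G + (s + q G) , f-magic
  }
  where
  open ≡-Reasoning
  S : Fin (q G) → ℕ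
  S = edgeSum G V

  r : Fin (q G) → ℕ
  r e = s + q G ∸ suc (S e)

  r<q : ∀ e → r e < q G
  r<q e = subst (r e <_) (m+n∸m≡n s (q G)) (∸-monoʳ-< (s≤s (s≤S e)) (S<s+q e))

  f : Elem G → Fin (p G + q G)
  f (inj₁ v) = fromℕ< (V<p v) ↑ˡ q G
  f (inj₂ e) = p G ↑ʳ fromℕ< (r<q e)

  toℕ-f-inj₁ : ∀ v → toℕ (f (inj₁ v)) ≡ V v
  toℕ-f-inj₁ v = trans (toℕ-↑ˡ _ (q G)) (toℕ-fromℕ< _)

  toℕ-f-inj₂ : ∀ e → toℕ (f (inj₂ e)) ≡ p G + r e
  toℕ-f-inj₂ e = trans (toℕ-↑ʳ (p G) _) (cong (p G +_) (toℕ-fromℕ< _))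

  f-injective : Injective _≡_ _≡_ f
  f-injective {inj₁ v} {inj₁ w} eq =
    cong inj₁ (V-injective (trans (sym (toℕ-f-inj₁ v)) (trans (cong toℕ eq) (toℕ-f-inj₁ w))))
  f-injective {inj₁ v} {inj₂ e} eq = contradiction eq (↑ˡ≢↑ʳ _ _)
  f-injective {inj₂ e} {inj₁ v} eq = contradiction (sym eq) (↑ˡ≢↑ʳ _ _)
  f-injective {inj₂ e} {inj₂ e′} eq = cong inj₂ (S-injective (suc-injective
    (∸-cancelˡ-≡ (S<s+q e) (S<s+q e′) (+-cancelˡ-≡ (p G) _ _
      (trans (sym (toℕ-f-inj₂ e)) (trans (cong toℕ eq) (toℕ-f-inj₂ e′)))))))

  f-magic : ∀ e → suc (toℕ (f (inj₁ (proj₁ (ends G e))))) + suc (toℕ (f (inj₂ e)))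
                    + suc (toℕ (f (inj₁ (proj₂ (ends G e))))) ≡ 2 + p G + (s + q G)
  f-magic e = begin
    suc (toℕ (f (inj₁ x))) + suc (toℕ (f (inj₂ e))) + suc (toℕ (f (inj₁ y)))
      ≡⟨ cong₂ (λ a c → suc a + suc c + suc (toℕ (f (inj₁ y)))) (toℕ-f-inj₁ x) (toℕ-f-inj₂ e) ⟩
    suc (V x) + suc (p G + r e) + suc (toℕ (f (inj₁ y)))
      ≡⟨ cong (λ b → suc (V x) + suc (p G + r e) + suc b) (toℕ-f-inj₁ y) ⟩
    suc (V x) + suc (p G + r e) + suc (V y)
      ≡⟨ magicSum-rearrange (V x) (V y) (p G + r e) ⟩
    3 + S e + (p G + r e)
      ≡⟨ regroup (S e) (p G) (r e) ⟩
    2 + p G + (suc (S e) + r e)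
      ≡⟨ cong (2 + p G +_) (m+[n∸m]≡n (S<s+q e)) ⟩
    2 + p G + (s + q G) ∎
    where
    x y : Fin (p G)
    x = proj₁ (ends G e)
    y = proj₂ (ends G e)
    regroup : ∀ a b c → 3 + a + (b + c) ≡ 2 + b + (suc a + c)
    regroup = solve-∀

indexedEdgeSums⇒superEdgeMagic : ∀ (G : Graph) (V : Fin (p G) → ℕ) s (σ : ℕ → ℕ) →
  (∀ v → V v < p G) → Injective _≡_ _≡_ V →
  (∀ e → edgeSum G V e ≡ σ (toℕ e)) → (∀ t → t < q G → s ≤ σ t × σ t < s + q G) →
  Injective _≡_ _≡_ σ → SuperEdgeMagic G
indexedEdgeSums⇒superEdgeMagic G V s σ V<p V-injective S≡σ σ-range σ-injective =
  consecutiveEdgeSums⇒superEdgeMagic G V s V<p V-injective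
    (λ e → subst (s ≤_) (sym (S≡σ e)) (proj₁ (σ-range _ (toℕ<n e))))
    (λ e → subst (_< s + q G) (sym (S≡σ e)) (proj₂ (σ-range _ (toℕ<n e))))
    (λ {e} {e′} eq → toℕ-injective (σ-injective (trans (sym (S≡σ e)) (trans eq (S≡σ e′)))))

pathEnds-loopless : ∀ n i → proj₁ (pathEnds n i) ≢ proj₂ (pathEnds n i)
pathEnds-loopless (suc n) i eq = 1+n≢n (sym (trans (sym (toℕ-inject₁ i)) (cong toℕ eq)))

PathJoinEmpty-loopless : ∀ n m → Loopless (PathJoinEmpty n m)
PathJoinEmpty-loopless n m e with splitAt (pred n) e
... | inj₁ i with pathEnds n i | pathEnds-loopless n i
...   | a , b | a≢b = a≢b ∘ ↑ˡ-injective m a b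
PathJoinEmpty-loopless n m e | inj₂ _ = ↑ˡ≢↑ʳ _ _

PathJoinEmpty-too-large : ∀ k b → let G = PathJoinEmpty (3 + k) (2 + b) in p G + p G ∸ 3 < q G
PathJoinEmpty-too-large k b = ≤-trans (m≤m+n _ (k + b + k * b)) (≤-reflexive (excess k b))
  where
  excess : ∀ k b → suc (k + (2 + b) + (3 + k + (2 + b))) + (k + b + k * b) ≡ 2 + k + (3 + k) * (2 + b)
  excess = solve-∀

PathJoinEmpty-notSuperEdgeMagic : ∀ k b → ¬ SuperEdgeMagic (PathJoinEmpty (3 + k) (2 + b))
PathJoinEmpty-notSuperEdgeMagic k b sem = <⇒≱ (PathJoinEmpty-too-large k b)
  (superEdgeMagic⇒size≤ _ (PathJoinEmpty-loopless (3 + k) (2 + b)) sem)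

PathJoinEmpty₁-edgeSum : ∀ m e → edgeSum (PathJoinEmpty 1 m) toℕ e ≡ suc (toℕ e)
PathJoinEmpty₁-edgeSum m e with splitAt m e in eq
... | inj₁ j = cong suc (sym (toℕ-splitAt-inj₁ eq))

PathJoinEmpty₁-superEdgeMagic : ∀ m → SuperEdgeMagic (PathJoinEmpty 1 m)
PathJoinEmpty₁-superEdgeMagic m = indexedEdgeSums⇒superEdgeMagic (PathJoinEmpty 1 m) toℕ 1 suc
  toℕ<n toℕ-injective (PathJoinEmpty₁-edgeSum m) (λ _ t<q → s≤s z≤n , s≤s t<q) suc-injective

-- u₁, u₂, v_j get labels 0, m + 1, j + 1.  Edges are indexed u₁u₂, then the u₁v_j, then the u₂v_j,
-- so in index order the edge sums are m + 1, then 1 … m, then m + 2 … 2m + 1.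
labelP₂ : ∀ m → Fin (2 + m) → ℕ
labelP₂ m F.zero            = 0
labelP₂ m (F.suc F.zero)    = suc m
labelP₂ m (F.suc (F.suc j)) = suc (toℕ j)

sumP₂ : ℕ → ℕ → ℕ
sumP₂ m zero = suc m
sumP₂ m (suc t) with t <? m
... | yes _ = suc t
... | no  _ = suc (suc t)

labelP₂<2+m : ∀ m v → labelP₂ m v < 2 + m
labelP₂<2+m m F.zero            = s≤s z≤n
labelP₂<2+m m (F.suc F.zero)    = n<1+n (suc m)
labelP₂<2+m m (F.suc (F.suc j)) = s≤s (m≤n⇒m≤1+n (toℕ<n j))

labelP₂-injective : ∀ m → Injective _≡_ _≡_ (labelP₂ m)
labelP₂-injective m {F.zero}            {F.zero}            _  = refl
labelP₂-injective m {F.suc F.zero}      {F.suc F.zero}      _  = refl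
labelP₂-injective m {F.suc (F.suc j)}   {F.suc (F.suc k)}   eq =
  cong (F.suc ∘ F.suc) (toℕ-injective (suc-injective eq))
labelP₂-injective m {F.suc F.zero}      {F.suc (F.suc k)}   eq =
  contradiction (toℕ<n k) (<-irrefl (sym (suc-injective eq)))
labelP₂-injective m {F.suc (F.suc j)}   {F.suc F.zero}      eq =
  contradiction (toℕ<n j) (<-irrefl (suc-injective eq))
labelP₂-injective m {F.zero}            {F.suc F.zero}      ()
labelP₂-injective m {F.zero}            {F.suc (F.suc _)}   ()
labelP₂-injective m {F.suc F.zero}      {F.zero}            ()
labelP₂-injective m {F.suc (F.suc _)}   {F.zero}            ()

sumP₂-below : ∀ {m t} → t < m → sumP₂ m (suc t) ≡ suc t
sumP₂-below {m} {t} t<m with t <? m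
... | yes _   = refl
... | no  t≮m = contradiction t<m t≮m

sumP₂-above : ∀ {m t} → m ≤ t → sumP₂ m (suc t) ≡ suc (suc t)
sumP₂-above {m} {t} m≤t with t <? m
... | yes t<m = contradiction m≤t (<⇒≱ t<m)
... | no  _   = refl

PathJoinEmpty₂-edgeSum : ∀ m e → edgeSum (PathJoinEmpty 2 m) (labelP₂ m) e ≡ sumP₂ m (toℕ e)
PathJoinEmpty₂-edgeSum m F.zero = refl
PathJoinEmpty₂-edgeSum m (F.suc c) with splitAt m c in eq
... | inj₁ j rewrite toℕ-splitAt-inj₁ eq = sym (sumP₂-below (toℕ<n j))
... | inj₂ c′ with splitAt m c′ in eq′
...   | inj₁ j rewrite toℕ-splitAt-inj₂ eq | toℕ-splitAt-inj₁ eq′ =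
  trans (cong suc (+-suc m (toℕ j))) (sym (sumP₂-above (m≤m+n m (toℕ j))))

sumP₂-range : ∀ m t → t < 1 + 2 * m → 1 ≤ sumP₂ m t × sumP₂ m t < 1 + (1 + 2 * m)
sumP₂-range m zero _ = s≤s z≤n , s≤s (s≤s (m≤m+n m _))
sumP₂-range m (suc t) t<q with t <? m
... | yes _ = s≤s z≤n , m≤n⇒m≤1+n t<q
... | no  _ = s≤s z≤n , s≤s t<q

sumP₂-injective : ∀ m → Injective _≡_ _≡_ (sumP₂ m)
sumP₂-injective m {zero} {zero} _ = refl
sumP₂-injective m {zero} {suc t} eq with t <? m
... | yes t<m = contradiction t<m (<-irrefl (sym (suc-injective eq)))
... | no  t≮m = contradiction (≤-reflexive (sym (suc-injective eq))) t≮m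
sumP₂-injective m {suc t} {zero} eq with t <? m
... | yes t<m = contradiction t<m (<-irrefl (suc-injective eq))
... | no  t≮m = contradiction (≤-reflexive (suc-injective eq)) t≮m
sumP₂-injective m {suc t} {suc t′} eq with t <? m | t′ <? m
... | yes _   | yes _    = eq
... | no  _   | no  _    = suc-injective eq
... | yes t<m | no  t′≮m = contradiction (≤-trans (≤-reflexive (sym (suc-injective eq))) (<⇒≤ t<m)) t′≮m
... | no  t≮m | yes t′<m = contradiction (≤-trans (≤-reflexive (suc-injective eq)) (<⇒≤ t′<m)) t≮m

PathJoinEmpty₂-superEdgeMagic : ∀ m → SuperEdgeMagic (PathJoinEmpty 2 m)
PathJoinEmpty₂-superEdgeMagic m = indexedEdgeSums⇒superEdgeMagic (PathJoinEmpty 2 m) (labelP₂ m) 1 (sumP₂ m)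
  (labelP₂<2+m m) (labelP₂-injective m) (PathJoinEmpty₂-edgeSum m) (sumP₂-range m) (sumP₂-injective m)

lemma3 : ∀ (n m : ℕ) → 1 ≤ n → 3 ≤ m →
    (SuperEdgeMagic (PathJoinEmpty n m) ⇔ (n ≡ 1 ⊎ n ≡ 2))
lemma3 1 m _ _ = mk⇔ (λ _ → inj₁ refl) (λ _ → PathJoinEmpty₁-superEdgeMagic m)
lemma3 2 m _ _ = mk⇔ (λ _ → inj₂ refl) (λ _ → PathJoinEmpty₂-superEdgeMagic m)
lemma3 (suc (suc (suc k))) (suc (suc b)) _ (s≤s (s≤s _)) =
  mk⇔ (⊥-elim ∘ PathJoinEmpty-notSuperEdgeMagic k b) λ { (inj₁ ()) ; (inj₂ ()) }
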